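{- For every integer $v>3$, writing $r_m=c_{2v,v-m}/c_{2v,v-1}$, $$\sum_{k=1}^{v-1}\frac{1}{k^4}=\frac{\pi^4}{90}-\zeta(4,v)=\frac{4}{9}\,r_2^2-\frac{4}{15}\,r_3.$$
   Context: For a complex parameter $\rho$, the generalized cosecant numbers $c_{\rho,k}$ ($k=0,1,2,\dots$) are defined by the power series expansion about $z=0$: $(z/\sin z)^{\rho}=\sum_{k\ge 0}c_{\rho,k}z^{2k}$ (principal branch, equal to $1$ at $z=0$); here $\rho=2v$. $\zeta(s,a)=\sum_{n\ge0}(n+a)^{ -s}$ denotes the Hurwitz zeta function. -}

module Defs where

open import Data.Nat as ℕ using (ℕ; zero; suc; _∸_; _!)
open import Data.Integer as ℤ using (+_)
open import Data.Rational using (ℚ; 0ℚ; 1ℚ; _+_; _*_; -_; _÷_; _/_)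
open import Data.Rational.Properties using (_≟_)
open import Data.List using (List; []; _∷_; _++_)
open import Relation.Nullary using (yes; no)
open import Data.Nat.Properties using (_!≢0)

sumBelow : ℕ → (ℕ → ℚ) → ℚ
sumBelow zero    f = 0ℚ
sumBelow (suc n) f = sumBelow n f + f n

-- Total division on ℚ: p ÷ q for q ≠ 0, and 0 when q = 0.
-- (Used only where the denominator is in fact nonzero.)
divℚ : ℚ → ℚ → ℚ
divℚ p q with q ≟ 0ℚ
... | yes _ = 0ℚ
... | no q≢0 = _÷_ p q {{Data.Rational.≢-nonZero q≢0}}
  where import Data.Rational

-- Power series in w = z² are represented by coefficient sequences ℕ → ℚ.

-- (sin z)/z = Σ_j (-1)^j z^{2j} / (2j+1)!
sincCoeff : ℕ → ℚ
sincCoeff j = sign j (_/_ (+ 1) ((suc (2 ℕ.* j)) !) {{(suc (2 ℕ.* j)) !≢0}})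
  where
  sign : ℕ → ℚ → ℚ
  sign zero    x = x
  sign (suc k) x = - sign k x

nth : List ℚ → ℕ → ℚ
nth []       _       = 0ℚ
nth (x ∷ xs) zero    = x
nth (x ∷ xs) (suc n) = nth xs n

-- Coefficients a_0, …, a_n of the reciprocal series z/sin z = 1 / ((sin z)/z),
-- determined by a_0 = 1 and Σ_{j=0}^{n} s_j a_{n-j} = 0 for n ≥ 1 (s_0 = 1).
cscCoeffs : ℕ → List ℚ
cscCoeffs zero    = 1ℚ ∷ []
cscCoeffs (suc n) =
  let prev = cscCoeffs n in
  prev ++ ((- sumBelow (suc n) (λ i → sincCoeff (suc i) * nth prev (n ∸ i))) ∷ [])

cscSeries : ℕ → ℚ
cscSeries k = nth (cscCoeffs k) k

mulSeries : (ℕ → ℚ) → (ℕ → ℚ) → (ℕ → ℚ)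
mulSeries f g n = sumBelow (suc n) (λ i → f i * g (n ∸ i))

oneSeries : ℕ → ℚ
oneSeries zero    = 1ℚ
oneSeries (suc _) = 0ℚ

powSeries : (ℕ → ℚ) → ℕ → (ℕ → ℚ)
powSeries f zero    = oneSeries
powSeries f (suc m) = mulSeries f (powSeries f m)

-- Generalized cosecant numbers c_{ρ,k} for a natural-number parameter ρ:
-- (z / sin z)^ρ = Σ_k c_{ρ,k} z^{2k}.
cosecNum : ℕ → ℕ → ℚ
cosecNum ρ = powSeries cscSeries ρ

{-# OPTIONS --safe #-}
module Submission where

-- Let S = sin z / z and T = z / sin z as power series in z², and θ = z d/dz.  From S T = 1,
-- θ cos = −z² S and cos² + z² S² = 1 one gets θ T = (1 − C) T, θ C = C − T² and C² = T² − z²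
-- for C = z cot z.  Hence y = Tⁿ satisfies θ²y − (2n + 1) θy + n(n + 1) y + n² z² y = n(n + 1) T² y,
-- whose coefficients give (2k − n)(2k − n − 1) c_{n,k} + n² c_{n,k−1} = n(n + 1) c_{n+2,k}.  Along
-- n = 2v, k = v − m for m = 1, 2, 3 this is first order in v, and induction from v = 3 gives
-- r₂ = (3/2) H₂ and r₃ = (15/4) (H₂² − H₄) with H_p = Σ_{0<j<v} j^(−p); eliminating H₂ leaves H₄.

open import Defs
open import Data.Nat as ℕ using (ℕ; zero; suc; _∸_; _^_; _<_; _≤_; s≤s; _!)
import Data.Nat.Properties as ℕP
open import Data.Nat.Properties using (_!≢0)
open import Data.Nat.GeneralisedArithmetic using (fold)
import Data.Nat.Coprimality as Coprime
open import Data.Integer as ℤ using (+_)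
open import Data.Integer.GCD using (gcd)
import Data.Integer.Properties as ℤP
open import Data.Rational as ℚ using (ℚ; 0ℚ; 1ℚ; _+_; _*_; -_; _-_; _/_)
import Data.Rational.Properties as ℚP
import Data.Rational.Unnormalised as ℚᵘ
import Data.Rational.Unnormalised.Properties as ℚᵘP
import Data.Rational.Solver as ℚSolver
open import Data.List using (List; []; _∷_; _++_; length)
import Data.List.Properties as LP
open import Data.Empty using (⊥-elim)
open import Data.Maybe using (just; nothing)
open import Data.Product using (_,_)
open import Data.Sum using (inj₁; inj₂)
open import Level using (0ℓ)
open import Algebra.Bundles using (CommutativeRing)
open import Algebra.Structures using (IsAbelianGroup)
open import Algebra.Consequences.Setoid using (comm∧idˡ⇒id; comm∧distrˡ⇒distr)
open import Algebra.Solver.Ring.AlmostCommutativeRing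
  using (_-Raw-AlmostCommutative⟶_; Induced-equivalence; fromCommutativeRing)
import Algebra.Solver.Ring
open import Relation.Binary.Definitions using (WeaklyDecidable)
open import Relation.Binary.Structures using (IsEquivalence)
import Relation.Binary.Reasoning.Setoid
open import Relation.Binary.PropositionalEquality
  using (_≡_; _≢_; refl; sym; trans; cong; cong₂; subst; module ≡-Reasoning)
open import Relation.Nullary using (yes; no)

fromℕ : ℕ → ℚ
fromℕ n = + n / 1

fromℕ-suc : ∀ n → fromℕ (suc n) ≡ 1ℚ + fromℕ n
fromℕ-suc n = ℚP.toℚᵘ-injective (begin
  ℚ.toℚᵘ (fromℕ (suc n))                ≈⟨ ℚP.toℚᵘ-fromℚᵘ _ ⟩
  ℚᵘ.mkℚᵘ (+ suc n) 0                   ≈⟨ ℚᵘ.*≡* (cong (ℤ._* + 1) (trans (ℤP.pos-+ 1 n) (cong (ℤ._+_ (+ 1)) (sym (ℤP.*-identityʳ (+ n)))))) ⟩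
  ℚᵘ.1ℚᵘ ℚᵘ.+ ℚᵘ.mkℚᵘ (+ n) 0           ≈⟨ ℚᵘP.+-congʳ ℚᵘ.1ℚᵘ (ℚᵘP.≃-sym (ℚP.toℚᵘ-fromℚᵘ (ℚᵘ.mkℚᵘ (+ n) 0))) ⟩
  ℚ.toℚᵘ 1ℚ ℚᵘ.+ ℚ.toℚᵘ (fromℕ n)      ≈⟨ ℚᵘP.≃-sym (ℚP.toℚᵘ-homo-+ 1ℚ (fromℕ n)) ⟩
  ℚ.toℚᵘ (1ℚ + fromℕ n)                ∎)
  where open ℚᵘP.≃-Reasoning

fromℕ-homo-+ : ∀ m n → fromℕ (m ℕ.+ n) ≡ fromℕ m + fromℕ n
fromℕ-homo-+ zero    n = sym (ℚP.+-identityˡ (fromℕ n))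
fromℕ-homo-+ (suc m) n = begin
  fromℕ (suc (m ℕ.+ n))          ≡⟨ fromℕ-suc (m ℕ.+ n) ⟩
  1ℚ + fromℕ (m ℕ.+ n)           ≡⟨ cong (_+_ 1ℚ) (fromℕ-homo-+ m n) ⟩
  1ℚ + (fromℕ m + fromℕ n)       ≡⟨ sym (ℚP.+-assoc 1ℚ (fromℕ m) (fromℕ n)) ⟩
  (1ℚ + fromℕ m) + fromℕ n       ≡⟨ cong (_+ fromℕ n) (sym (fromℕ-suc m)) ⟩
  fromℕ (suc m) + fromℕ n        ∎
  where open ≡-Reasoning

fromℕ-homo-* : ∀ m n → fromℕ (m ℕ.* n) ≡ fromℕ m * fromℕ n
fromℕ-homo-* zero    n = sym (ℚP.*-zeroˡ (fromℕ n))
fromℕ-homo-* (suc m) n = begin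
  fromℕ (n ℕ.+ m ℕ.* n)               ≡⟨ fromℕ-homo-+ n (m ℕ.* n) ⟩
  fromℕ n + fromℕ (m ℕ.* n)           ≡⟨ cong (_+_ (fromℕ n)) (fromℕ-homo-* m n) ⟩
  fromℕ n + fromℕ m * fromℕ n         ≡⟨ cong (_+ fromℕ m * fromℕ n) (sym (ℚP.*-identityˡ (fromℕ n))) ⟩
  1ℚ * fromℕ n + fromℕ m * fromℕ n    ≡⟨ sym (ℚP.*-distribʳ-+ (fromℕ n) 1ℚ (fromℕ m)) ⟩
  (1ℚ + fromℕ m) * fromℕ n            ≡⟨ cong (_* fromℕ n) (sym (fromℕ-suc m)) ⟩
  fromℕ (suc m) * fromℕ n             ∎
  where open ≡-Reasoning

fromℕ≢0 : ∀ n .{{_ : ℕ.NonZero n}} → fromℕ n ≢ 0ℚ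
fromℕ≢0 (suc n) eq with trans (sym (ℚP.↥-/ (+ suc n) 1)) (cong (λ p → ℚ.↥ p ℤ.* gcd (+ suc n) (+ 1)) eq)
... | ()

fromℕ-inverse : ∀ n .{{_ : ℕ.NonZero n}} → (+ 1 / n) * fromℕ n ≡ 1ℚ
fromℕ-inverse (suc n) = trans (cong₂ _*_ (ℚP.↥p/↧p≡p (ℚ.1/ p)) (ℚP.↥p/↧p≡p p)) (ℚP.*-inverseˡ p)
  where p = ℚ.mkℚ (+ suc n) 0 (Coprime.sym (Coprime.1-coprimeTo (suc n)))

*-cancelʳ-≢0 : ∀ {p q} r → r ≢ 0ℚ → p * r ≡ q * r → p ≡ q
*-cancelʳ-≢0 {p} {q} r r≢0 eq = begin
  p                 ≡⟨ sym (ℚP.*-identityʳ p) ⟩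
  p * 1ℚ            ≡⟨ cong (p *_) (sym (ℚP.*-inverseʳ r)) ⟩
  p * (r * ℚ.1/ r)  ≡⟨ sym (ℚP.*-assoc p r _) ⟩
  p * r * ℚ.1/ r    ≡⟨ cong (_* ℚ.1/ r) eq ⟩
  q * r * ℚ.1/ r    ≡⟨ ℚP.*-assoc q r _ ⟩
  q * (r * ℚ.1/ r)  ≡⟨ cong (q *_) (ℚP.*-inverseʳ r) ⟩
  q * 1ℚ            ≡⟨ ℚP.*-identityʳ q ⟩
  q                 ∎
  where
  open ≡-Reasoning
  instance _ = ℚ.≢-nonZero r≢0

*-cancelˡ-≢0 : ∀ {p q} r → r ≢ 0ℚ → r * p ≡ r * q → p ≡ q
*-cancelˡ-≢0 {p} {q} r r≢0 eq = *-cancelʳ-≢0 r r≢0 (trans (ℚP.*-comm p r) (trans eq (ℚP.*-comm r q)))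

*-≢0 : ∀ {p q} → p ≢ 0ℚ → q ≢ 0ℚ → p * q ≢ 0ℚ
*-≢0 {p} {q} p≢0 q≢0 pq≡0 = p≢0 (*-cancelʳ-≢0 q q≢0 (trans pq≡0 (sym (ℚP.*-zeroˡ q))))

divℚ-cancelʳ : ∀ p {q} → q ≢ 0ℚ → divℚ p q * q ≡ p
divℚ-cancelʳ p {q} q≢0 with q ℚP.≟ 0ℚ
... | yes q≡0 = ⊥-elim (q≢0 q≡0)
... | no  _   = trans (ℚP.*-assoc p _ q) (trans (cong (p *_) (ℚP.*-inverseˡ q)) (ℚP.*-identityʳ p))
  where instance _ = ℚ.≢-nonZero q≢0

divℚ-unique : ∀ {p q r} → q ≢ 0ℚ → r * q ≡ p → divℚ p q ≡ r
divℚ-unique {p} q≢0 eq = *-cancelʳ-≢0 _ q≢0 (trans (divℚ-cancelʳ p q≢0) (sym eq))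

sumBelow-cong : ∀ n {f g : ℕ → ℚ} → (∀ i → i < n → f i ≡ g i) → sumBelow n f ≡ sumBelow n g
sumBelow-cong zero    f≡g = refl
sumBelow-cong (suc n) f≡g = cong₂ _+_ (sumBelow-cong n (λ i i<n → f≡g i (ℕP.m<n⇒m<1+n i<n))) (f≡g n (ℕP.n<1+n n))

sumBelow-zero : ∀ n {f : ℕ → ℚ} → (∀ i → f i ≡ 0ℚ) → sumBelow n f ≡ 0ℚ
sumBelow-zero zero    f≡0 = refl
sumBelow-zero (suc n) f≡0 = trans (cong₂ _+_ (sumBelow-zero n f≡0) (f≡0 n)) (ℚP.+-identityˡ 0ℚ)

sumBelow-distrib-+ : ∀ n (f g : ℕ → ℚ) → sumBelow n (λ i → f i + g i) ≡ sumBelow n f + sumBelow n g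
sumBelow-distrib-+ zero    f g = refl
sumBelow-distrib-+ (suc n) f g = trans (cong (_+ (f n + g n)) (sumBelow-distrib-+ n f g))
    (solve 4 (λ a b c d → (a :+ b) :+ (c :+ d) := (a :+ c) :+ (b :+ d)) refl (sumBelow n f) (sumBelow n g) (f n) (g n))
  where open ℚSolver.+-*-Solver

sumBelow-*ˡ : ∀ n c (f : ℕ → ℚ) → sumBelow n (λ i → c * f i) ≡ c * sumBelow n f
sumBelow-*ˡ zero    c f = sym (ℚP.*-zeroʳ c)
sumBelow-*ˡ (suc n) c f = trans (cong (_+ c * f n) (sumBelow-*ˡ n c f)) (sym (ℚP.*-distribˡ-+ c (sumBelow n f) (f n)))

sumBelow-*ʳ : ∀ n c (f : ℕ → ℚ) → sumBelow n (λ i → f i * c) ≡ sumBelow n f * c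
sumBelow-*ʳ n c f = trans (sumBelow-cong n (λ i _ → ℚP.*-comm (f i) c))
                          (trans (sumBelow-*ˡ n c f) (ℚP.*-comm c (sumBelow n f)))

sumBelow-head : ∀ n (f : ℕ → ℚ) → sumBelow (suc n) f ≡ f 0 + sumBelow n (λ i → f (suc i))
sumBelow-head zero    f = ℚP.+-comm 0ℚ (f 0)
sumBelow-head (suc n) f = trans (cong (_+ f (suc n)) (sumBelow-head n f)) (ℚP.+-assoc (f 0) _ (f (suc n)))

sumBelow-reverse : ∀ n (f : ℕ → ℚ) → sumBelow (suc n) f ≡ sumBelow (suc n) (λ i → f (n ∸ i))
sumBelow-reverse zero    f = refl
sumBelow-reverse (suc n) f = begin
  sumBelow (suc n) f + f (suc n)                         ≡⟨ cong (_+ f (suc n)) (sumBelow-reverse n f) ⟩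
  sumBelow (suc n) (λ i → f (n ∸ i)) + f (suc n)         ≡⟨ ℚP.+-comm _ (f (suc n)) ⟩
  f (suc n) + sumBelow (suc n) (λ i → f (n ∸ i))         ≡⟨ sym (sumBelow-head (suc n) (λ i → f (suc n ∸ i))) ⟩
  sumBelow (suc (suc n)) (λ i → f (suc n ∸ i))           ∎
  where open ≡-Reasoning

sumBelow-triangle : ∀ n (G : ℕ → ℕ → ℚ) →
  sumBelow n (λ s → sumBelow (suc s) (λ i → G i s)) ≡ sumBelow n (λ i → sumBelow (n ∸ i) (λ j → G i (i ℕ.+ j)))
sumBelow-triangle zero    G = refl
sumBelow-triangle (suc n) G = begin
  sumBelow n (λ s → sumBelow (suc s) (λ i → G i s)) + sumBelow (suc n) (λ i → G i n)
    ≡⟨ cong (_+ sumBelow (suc n) (λ i → G i n)) (sumBelow-triangle n G) ⟩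
  sumBelow n rows + sumBelow (suc n) (λ i → G i n)
    ≡⟨ cong (_+ sumBelow (suc n) (λ i → G i n)) (sym (ℚP.+-identityʳ (sumBelow n rows))) ⟩
  (sumBelow n rows + 0ℚ) + sumBelow (suc n) (λ i → G i n)
    ≡⟨ cong (λ k → (sumBelow n rows + sumBelow k (λ j → G n (n ℕ.+ j))) + sumBelow (suc n) (λ i → G i n)) (sym (ℕP.n∸n≡0 n)) ⟩
  sumBelow (suc n) rows + sumBelow (suc n) (λ i → G i n)
    ≡⟨ sym (sumBelow-distrib-+ (suc n) rows (λ i → G i n)) ⟩
  sumBelow (suc n) (λ i → rows i + G i n)
    ≡⟨ sumBelow-cong (suc n) extend-row ⟩
  sumBelow (suc n) (λ i → sumBelow (suc n ∸ i) (λ j → G i (i ℕ.+ j)))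
    ∎
  where
  open ≡-Reasoning
  rows : ℕ → ℚ
  rows i = sumBelow (n ∸ i) (λ j → G i (i ℕ.+ j))
  extend-row : ∀ i → i < suc n → rows i + G i n ≡ sumBelow (suc n ∸ i) (λ j → G i (i ℕ.+ j))
  extend-row i (s≤s i≤n) = begin
    rows i + G i n                                   ≡⟨ cong (λ k → rows i + G i k) (sym (ℕP.m+[n∸m]≡n i≤n)) ⟩
    sumBelow (suc (n ∸ i)) (λ j → G i (i ℕ.+ j))     ≡⟨ cong (λ k → sumBelow k (λ j → G i (i ℕ.+ j))) (sym (ℕP.+-∸-assoc 1 i≤n)) ⟩
    sumBelow (suc n ∸ i) (λ j → G i (i ℕ.+ j))       ∎

-- The ring of power series in z²

Series : Set
Series = ℕ → ℚ

infix  4 _≈_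
infixl 6 _⊕_
infixl 7 _⊗_
infix  8 ⊖_

record _≈_ (f g : Series) : Set where
  constructor mk≈
  field at : ∀ k → f k ≡ g k
open _≈_

𝟘 : Series
𝟘 _ = 0ℚ

scalar : ℚ → Series
scalar q zero    = q
scalar q (suc _) = 0ℚ

z² : Series
z² 1 = 1ℚ
z² _ = 0ℚ

-- The operations are opaque: unfolded, `f ⊕ g` is a λ-term from which unification cannot
-- recover `f` and `g`, which the congruence steps of setoid reasoning rely on.
opaque
  _⊕_ : Series → Series → Series
  (f ⊕ g) k = f k + g k

  ⊖_ : Series → Series
  (⊖ f) k = - f k

  _⊗_ : Series → Series → Series
  _⊗_ = mulSeries

  ⊗-cong : ∀ {f f′ g g′} → f ≈ f′ → g ≈ g′ → f ⊗ g ≈ f′ ⊗ g′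
  ⊗-cong f≈f′ g≈g′ = mk≈ λ n → sumBelow-cong (suc n) (λ i _ → cong₂ _*_ (at f≈f′ i) (at g≈g′ (n ∸ i)))

  ⊗-comm : ∀ f g → f ⊗ g ≈ g ⊗ f
  ⊗-comm f g = mk≈ λ n → trans (sumBelow-reverse n _) (sumBelow-cong (suc n) (swap n))
    where
    swap : ∀ n i → i < suc n → f (n ∸ i) * g (n ∸ (n ∸ i)) ≡ g i * f (n ∸ i)
    swap n i (s≤s i≤n) = trans (cong (λ k → f (n ∸ i) * g k) (ℕP.m∸[m∸n]≡n i≤n)) (ℚP.*-comm (f (n ∸ i)) (g i))

  ⊗-assoc : ∀ f g h → (f ⊗ g) ⊗ h ≈ f ⊗ (g ⊗ h)
  ⊗-assoc f g h = mk≈ assoc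
    where
    open ≡-Reasoning
    row : ∀ n i → i < suc n →
          sumBelow (suc n ∸ i) (λ j → f i * g (i ℕ.+ j ∸ i) * h (n ∸ (i ℕ.+ j)))
          ≡ f i * sumBelow (suc (n ∸ i)) (λ j → g j * h (n ∸ i ∸ j))
    row n i (s≤s i≤n) = begin
      sumBelow (suc n ∸ i) (λ j → f i * g (i ℕ.+ j ∸ i) * h (n ∸ (i ℕ.+ j)))
        ≡⟨ cong (λ k → sumBelow k (λ j → f i * g (i ℕ.+ j ∸ i) * h (n ∸ (i ℕ.+ j)))) (ℕP.+-∸-assoc 1 i≤n) ⟩
      sumBelow (suc (n ∸ i)) (λ j → f i * g (i ℕ.+ j ∸ i) * h (n ∸ (i ℕ.+ j)))
        ≡⟨ sumBelow-cong (suc (n ∸ i)) (λ j _ → trans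
             (cong₂ (λ a b → f i * g a * h b) (ℕP.m+n∸m≡n i j) (sym (ℕP.∸-+-assoc n i j)))
             (ℚP.*-assoc (f i) _ _)) ⟩
      sumBelow (suc (n ∸ i)) (λ j → f i * (g j * h (n ∸ i ∸ j)))
        ≡⟨ sumBelow-*ˡ (suc (n ∸ i)) (f i) (λ j → g j * h (n ∸ i ∸ j)) ⟩
      f i * sumBelow (suc (n ∸ i)) (λ j → g j * h (n ∸ i ∸ j))
        ∎
    assoc : ∀ n → ((f ⊗ g) ⊗ h) n ≡ (f ⊗ (g ⊗ h)) n
    assoc n = begin
      sumBelow (suc n) (λ s → sumBelow (suc s) (λ i → f i * g (s ∸ i)) * h (n ∸ s))
        ≡⟨ sumBelow-cong (suc n) (λ s _ → sym (sumBelow-*ʳ (suc s) (h (n ∸ s)) (λ i → f i * g (s ∸ i)))) ⟩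
      sumBelow (suc n) (λ s → sumBelow (suc s) (λ i → f i * g (s ∸ i) * h (n ∸ s)))
        ≡⟨ sumBelow-triangle (suc n) (λ i s → f i * g (s ∸ i) * h (n ∸ s)) ⟩
      sumBelow (suc n) (λ i → sumBelow (suc n ∸ i) (λ j → f i * g (i ℕ.+ j ∸ i) * h (n ∸ (i ℕ.+ j))))
        ≡⟨ sumBelow-cong (suc n) (row n) ⟩
      sumBelow (suc n) (λ i → f i * sumBelow (suc (n ∸ i)) (λ j → g j * h (n ∸ i ∸ j)))
        ∎

  ⊗-distribˡ-⊕ : ∀ f g h → f ⊗ (g ⊕ h) ≈ f ⊗ g ⊕ f ⊗ h
  ⊗-distribˡ-⊕ f g h = mk≈ λ n → trans (sumBelow-cong (suc n) (λ i _ → ℚP.*-distribˡ-+ (f i) _ _)) (sumBelow-distrib-+ (suc n) _ _)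

  ⊗-constantˡ : ∀ {c} → (∀ i → c (suc i) ≡ 0ℚ) → ∀ f k → (c ⊗ f) k ≡ c 0 * f k
  ⊗-constantˡ {c} c₊≡0 f k = begin
    sumBelow (suc k) (λ i → c i * f (k ∸ i))                   ≡⟨ sumBelow-head k _ ⟩
    c 0 * f k + sumBelow k (λ i → c (suc i) * f (k ∸ suc i))   ≡⟨ cong (_+_ (c 0 * f k)) (sumBelow-zero k vanish) ⟩
    c 0 * f k + 0ℚ                                             ≡⟨ ℚP.+-identityʳ _ ⟩
    c 0 * f k                                                  ∎
    where
    open ≡-Reasoning
    vanish : ∀ i → c (suc i) * f (k ∸ suc i) ≡ 0ℚ
    vanish i = trans (cong (_* f (k ∸ suc i)) (c₊≡0 i)) (ℚP.*-zeroˡ (f (k ∸ suc i)))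

  scalar-*ˡ : ∀ q f k → (scalar q ⊗ f) k ≡ q * f k
  scalar-*ˡ q = ⊗-constantˡ {scalar q} (λ _ → refl)

  ⊗-identityˡ : ∀ f → scalar 1ℚ ⊗ f ≈ f
  ⊗-identityˡ f = mk≈ λ k → trans (scalar-*ˡ 1ℚ f k) (ℚP.*-identityˡ (f k))

  ≈-isEquivalence : IsEquivalence _≈_
  ≈-isEquivalence = record
    { refl  = mk≈ λ _ → refl
    ; sym   = λ f≈g → mk≈ λ k → sym (at f≈g k)
    ; trans = λ f≈g g≈h → mk≈ λ k → trans (at f≈g k) (at g≈h k)
    }

  ⊕-isAbelianGroup : IsAbelianGroup _≈_ _⊕_ 𝟘 ⊖_
  ⊕-isAbelianGroup = record
    { isGroup = record
      { isMonoid = record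
        { isSemigroup = record
          { isMagma = record
            { isEquivalence = ≈-isEquivalence
            ; ∙-cong        = λ f≈f′ g≈g′ → mk≈ λ k → cong₂ _+_ (at f≈f′ k) (at g≈g′ k)
            }
          ; assoc = λ f g h → mk≈ λ k → ℚP.+-assoc (f k) (g k) (h k)
          }
        ; identity = (λ f → mk≈ λ k → ℚP.+-identityˡ (f k)) , (λ f → mk≈ λ k → ℚP.+-identityʳ (f k))
        }
      ; inverse = (λ f → mk≈ λ k → ℚP.+-inverseˡ (f k)) , (λ f → mk≈ λ k → ℚP.+-inverseʳ (f k))
      ; ⁻¹-cong = λ f≈g → mk≈ λ k → cong -_ (at f≈g k)
      }
    ; comm = λ f g → mk≈ λ k → ℚP.+-comm (f k) (g k)
    }

  scalar-0 : scalar 0ℚ ≈ 𝟘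
  scalar-0 = mk≈ λ { zero → refl ; (suc k) → refl }

  z²-⊗-zero : ∀ f → (z² ⊗ f) 0 ≡ 0ℚ
  z²-⊗-zero f = trans (ℚP.+-identityˡ _) (ℚP.*-zeroˡ (f 0))

  z²-⊗-suc : ∀ f k → (z² ⊗ f) (suc k) ≡ f k
  z²-⊗-suc f k = begin
    (z² ⊗ f) (suc k)                                     ≡⟨ sumBelow-head (suc k) _ ⟩
    0ℚ * f (suc k) + ((λ i → z² (suc i)) ⊗ f) k         ≡⟨ cong₂ _+_ (ℚP.*-zeroˡ (f (suc k))) (⊗-constantˡ {λ i → z² (suc i)} (λ _ → refl) f k) ⟩
    0ℚ + 1ℚ * f k                                        ≡⟨ trans (ℚP.+-identityˡ _) (ℚP.*-identityˡ (f k)) ⟩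
    f k                                                  ∎
    where open ≡-Reasoning

  scalar-+ : ∀ p q → scalar (p + q) ≈ scalar p ⊕ scalar q
  scalar-+ p q = mk≈ λ { zero → refl ; (suc k) → sym (ℚP.+-identityˡ 0ℚ) }

  scalar-neg : ∀ p → scalar (- p) ≈ ⊖ scalar p
  scalar-neg p = mk≈ λ { zero → refl ; (suc k) → refl }

  scalar-* : ∀ p q → scalar (p * q) ≈ scalar p ⊗ scalar q
  scalar-* p q = mk≈ λ { zero → sym (scalar-*ˡ p (scalar q) 0)
                       ; (suc k) → sym (trans (scalar-*ˡ p (scalar q) (suc k)) (ℚP.*-zeroʳ p)) }

  powSeries-zero : ∀ f → powSeries f 0 ≈ scalar 1ℚ
  powSeries-zero f = mk≈ λ { zero → refl ; (suc k) → refl }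

  powSeries-suc : ∀ f n → powSeries f (suc n) ≈ f ⊗ powSeries f n
  powSeries-suc f n = mk≈ λ _ → refl

seriesRing : CommutativeRing 0ℓ 0ℓ
seriesRing = record
  { Carrier           = Series
  ; _≈_               = _≈_
  ; _+_               = _⊕_
  ; _*_               = _⊗_
  ; -_                = ⊖_
  ; 0#                = 𝟘
  ; 1#                = scalar 1ℚ
  ; isCommutativeRing = record
    { isRing = record
      { +-isAbelianGroup = ⊕-isAbelianGroup
      ; *-cong           = ⊗-cong
      ; *-assoc          = ⊗-assoc
      ; *-identity       = comm∧idˡ⇒id setoid ⊗-comm {scalar 1ℚ} ⊗-identityˡ
      ; distrib          = comm∧distrˡ⇒distr setoid +-cong ⊗-comm ⊗-distribˡ-⊕
      }
    ; *-comm = ⊗-comm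
    }
  }
  where
  open IsAbelianGroup ⊕-isAbelianGroup using (setoid) renaming (∙-cong to +-cong)

scalar-morphism : CommutativeRing.rawRing ℚP.+-*-commutativeRing -Raw-AlmostCommutative⟶ fromCommutativeRing seriesRing
scalar-morphism = record
  { ⟦_⟧    = scalar
  ; +-homo = scalar-+
  ; *-homo = scalar-*
  ; -‿homo = scalar-neg
  ; 0-homo = scalar-0
  ; 1-homo = mk≈ λ _ → refl
  }

scalar-≟ : WeaklyDecidable (Induced-equivalence scalar-morphism)
scalar-≟ p q with p ℚP.≟ q
... | yes refl = just (mk≈ λ _ → refl)
... | no  _    = nothing

module SeriesSolver = Algebra.Solver.Ring (CommutativeRing.rawRing ℚP.+-*-commutativeRing)
                                          (fromCommutativeRing seriesRing) scalar-morphism scalar-≟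

open CommutativeRing seriesRing
  using (setoid; +-cong; +-congˡ; +-congʳ; *-cong; *-congˡ; *-congʳ; -‿cong)
  renaming (refl to ≈-refl; sym to ≈-sym; trans to ≈-trans)

module ≈-Reasoning = Relation.Binary.Reasoning.Setoid setoid

scalar-cong : ∀ {p q} → p ≡ q → scalar p ≈ scalar q
scalar-cong refl = mk≈ λ _ → refl

-- The Euler operator θ = z d/dz

opaque
  unfolding _⊕_ ⊖_ _⊗_

  θ : Series → Series
  θ f k = fromℕ (2 ℕ.* k) * f k

  θ-cong : ∀ {f g} → f ≈ g → θ f ≈ θ g
  θ-cong f≈g = mk≈ λ k → cong (fromℕ (2 ℕ.* k) *_) (at f≈g k)

  θ-⊕ : ∀ f g → θ (f ⊕ g) ≈ θ f ⊕ θ g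
  θ-⊕ f g = mk≈ λ k → ℚP.*-distribˡ-+ (fromℕ (2 ℕ.* k)) (f k) (g k)

  θ-⊖ : ∀ f → θ (⊖ f) ≈ ⊖ θ f
  θ-⊖ f = mk≈ λ k → sym (ℚP.neg-distribʳ-* (fromℕ (2 ℕ.* k)) (f k))

  θ-scalar : ∀ q → θ (scalar q) ≈ 𝟘
  θ-scalar q = mk≈ λ { zero → ℚP.*-zeroˡ q ; (suc k) → ℚP.*-zeroʳ (fromℕ (2 ℕ.* suc k)) }

  θ-z² : θ z² ≈ z² ⊕ z²
  θ-z² = mk≈ λ { 0 → refl ; 1 → refl ; (suc (suc k)) → ℚP.*-zeroʳ (fromℕ (2 ℕ.* suc (suc k))) }

  θ-leibniz : ∀ f g → θ (f ⊗ g) ≈ θ f ⊗ g ⊕ f ⊗ θ g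
  θ-leibniz f g = mk≈ leibniz
    where
    open ≡-Reasoning
    split : ∀ n i → i ℕ.≤ n → fromℕ (2 ℕ.* n) * (f i * g (n ∸ i)) ≡ θ f i * g (n ∸ i) + f i * θ g (n ∸ i)
    split n i i≤n = begin
      fromℕ (2 ℕ.* n) * (f i * g (n ∸ i))
        ≡⟨ cong (λ m → fromℕ (2 ℕ.* m) * (f i * g (n ∸ i))) (sym (ℕP.m+[n∸m]≡n i≤n)) ⟩
      fromℕ (2 ℕ.* (i ℕ.+ (n ∸ i))) * (f i * g (n ∸ i))
        ≡⟨ cong (_* (f i * g (n ∸ i))) (trans (cong fromℕ (ℕP.*-distribˡ-+ 2 i (n ∸ i))) (fromℕ-homo-+ (2 ℕ.* i) (2 ℕ.* (n ∸ i)))) ⟩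
      (fromℕ (2 ℕ.* i) + fromℕ (2 ℕ.* (n ∸ i))) * (f i * g (n ∸ i))
        ≡⟨ solve 4 (λ a b x y → (a :+ b) :* (x :* y) := a :* x :* y :+ x :* (b :* y)) refl (fromℕ (2 ℕ.* i)) (fromℕ (2 ℕ.* (n ∸ i))) (f i) (g (n ∸ i)) ⟩
      θ f i * g (n ∸ i) + f i * θ g (n ∸ i)
        ∎
      where open ℚSolver.+-*-Solver
    leibniz : ∀ n → θ (f ⊗ g) n ≡ (θ f ⊗ g ⊕ f ⊗ θ g) n
    leibniz n = begin
      fromℕ (2 ℕ.* n) * sumBelow (suc n) (λ i → f i * g (n ∸ i))
        ≡⟨ sym (sumBelow-*ˡ (suc n) (fromℕ (2 ℕ.* n)) (λ i → f i * g (n ∸ i))) ⟩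
      sumBelow (suc n) (λ i → fromℕ (2 ℕ.* n) * (f i * g (n ∸ i)))
        ≡⟨ sumBelow-cong (suc n) (λ i i<1+n → split n i (ℕP.≤-pred i<1+n)) ⟩
      sumBelow (suc n) (λ i → θ f i * g (n ∸ i) + f i * θ g (n ∸ i))
        ≡⟨ sumBelow-distrib-+ (suc n) _ _ ⟩
      (θ f ⊗ g ⊕ f ⊗ θ g) n
        ∎

  θ-kernel : ∀ {f q} → θ f ≈ 𝟘 → f 0 ≡ q → f ≈ scalar q
  θ-kernel {f} θf≈0 f0≡q = mk≈ λ
    { zero    → f0≡q
    ; (suc k) → *-cancelˡ-≢0 (fromℕ (2 ℕ.* suc k)) (fromℕ≢0 (2 ℕ.* suc k))
                  (trans (at θf≈0 (suc k)) (sym (ℚP.*-zeroʳ (fromℕ (2 ℕ.* suc k)))))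
    }

θ-scalar-⊗ : ∀ q f → θ (scalar q ⊗ f) ≈ scalar q ⊗ θ f
θ-scalar-⊗ q f = begin
  θ (scalar q ⊗ f)                            ≈⟨ θ-leibniz (scalar q) f ⟩
  θ (scalar q) ⊗ f ⊕ scalar q ⊗ θ f           ≈⟨ +-congʳ (*-congʳ (≈-trans (θ-scalar q) (≈-sym scalar-0))) ⟩
  scalar 0ℚ ⊗ f ⊕ scalar q ⊗ θ f              ≈⟨ solve 3 (λ f f′ c → con 0ℚ :* f :+ c :* f′ := c :* f′) ≈-refl f (θ f) (scalar q) ⟩
  scalar q ⊗ θ f                              ∎
  where
  open SeriesSolver
  open ≈-Reasoning

θ-reciprocal : ∀ {f g} → f ⊗ g ≈ scalar 1ℚ → θ g ≈ ⊖ (g ⊗ g ⊗ θ f)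
θ-reciprocal {f} {g} fg≈1 = begin
  θ g
    ≈⟨ solve 1 (λ g′ → g′ := g′ :* con 1ℚ) ≈-refl (θ g) ⟩
  θ g ⊗ scalar 1ℚ
    ≈⟨ *-congˡ (≈-sym fg≈1) ⟩
  θ g ⊗ (f ⊗ g)
    ≈⟨ solve 4 (λ f g f′ g′ → g′ :* (f :* g) := g :* (f′ :* g :+ f :* g′) :- g :* g :* f′) ≈-refl f g (θ f) (θ g) ⟩
  g ⊗ (θ f ⊗ g ⊕ f ⊗ θ g) ⊕ ⊖ (g ⊗ g ⊗ θ f)
    ≈⟨ +-congʳ (*-congˡ (≈-sym (θ-leibniz f g))) ⟩
  g ⊗ θ (f ⊗ g) ⊕ ⊖ (g ⊗ g ⊗ θ f)
    ≈⟨ +-congʳ (*-congˡ (≈-trans (θ-cong fg≈1) (≈-trans (θ-scalar 1ℚ) (≈-sym scalar-0)))) ⟩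
  g ⊗ scalar 0ℚ ⊕ ⊖ (g ⊗ g ⊗ θ f)
    ≈⟨ solve 2 (λ g f′ → g :* con 0ℚ :- g :* g :* f′ := :- (g :* g :* f′)) ≈-refl g (θ f) ⟩
  ⊖ (g ⊗ g ⊗ θ f)
    ∎
  where
  open SeriesSolver
  open ≈-Reasoning

θ-pow : ∀ {f g} → θ f ≈ g ⊗ f → ∀ n → θ (powSeries f n) ≈ scalar (fromℕ n) ⊗ (g ⊗ powSeries f n)
θ-pow {f} {g} θf≈gf zero = begin
  θ (powSeries f 0)                            ≈⟨ ≈-trans (θ-cong (powSeries-zero f)) (≈-trans (θ-scalar 1ℚ) (≈-sym scalar-0)) ⟩
  scalar 0ℚ                                    ≈⟨ solve 2 (λ g p → con 0ℚ := con 0ℚ :* (g :* p)) ≈-refl g (powSeries f 0) ⟩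
  scalar 0ℚ ⊗ (g ⊗ powSeries f 0)              ∎
  where
  open SeriesSolver
  open ≈-Reasoning
θ-pow {f} {g} θf≈gf (suc n) = begin
  θ (powSeries f (suc n))                      ≈⟨ θ-cong (powSeries-suc f n) ⟩
  θ (f ⊗ p)                                    ≈⟨ θ-leibniz f p ⟩
  θ f ⊗ p ⊕ f ⊗ θ p                            ≈⟨ +-cong (*-congʳ θf≈gf) (*-congˡ (θ-pow θf≈gf n)) ⟩
  g ⊗ f ⊗ p ⊕ f ⊗ (m ⊗ (g ⊗ p))                ≈⟨ solve 4 (λ f g p m → g :* f :* p :+ f :* (m :* (g :* p)) := (con 1ℚ :+ m) :* (g :* (f :* p))) ≈-refl f g p m ⟩
  (scalar 1ℚ ⊕ m) ⊗ (g ⊗ (f ⊗ p))              ≈⟨ *-cong (≈-trans (≈-sym (scalar-+ 1ℚ (fromℕ n))) (scalar-cong (sym (fromℕ-suc n)))) (*-congˡ (≈-sym (powSeries-suc f n))) ⟩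
  scalar (fromℕ (suc n)) ⊗ (g ⊗ powSeries f (suc n)) ∎
  where
  open SeriesSolver
  open ≈-Reasoning
  p m : Series
  p = powSeries f n
  m = scalar (fromℕ n)

-- sin, cos, csc and cot

invFactorial : ℕ → ℚ
invFactorial n = (+ 1 / n !) {{n !≢0}}

invFactorial-suc : ∀ m → fromℕ (suc m) * invFactorial (suc m) ≡ invFactorial m
invFactorial-suc m = *-cancelʳ-≢0 (fromℕ (suc m !)) (fromℕ≢0 (suc m !) {{suc m !≢0}}) (begin
  fromℕ (suc m) * invFactorial (suc m) * fromℕ (suc m !)    ≡⟨ ℚP.*-assoc (fromℕ (suc m)) _ _ ⟩
  fromℕ (suc m) * (invFactorial (suc m) * fromℕ (suc m !))  ≡⟨ cong (_*_ (fromℕ (suc m))) (fromℕ-inverse (suc m !) {{suc m !≢0}}) ⟩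
  fromℕ (suc m) * 1ℚ                                        ≡⟨ cong (_*_ (fromℕ (suc m))) (sym (fromℕ-inverse (m !) {{m !≢0}})) ⟩
  fromℕ (suc m) * (invFactorial m * fromℕ (m !))            ≡⟨ solve 3 (λ a b c → a :* (b :* c) := b :* (a :* c)) refl (fromℕ (suc m)) (invFactorial m) (fromℕ (m !)) ⟩
  invFactorial m * (fromℕ (suc m) * fromℕ (m !))            ≡⟨ cong (_*_ (invFactorial m)) (sym (fromℕ-homo-* (suc m) (m !))) ⟩
  invFactorial m * fromℕ (suc m !)                          ∎)
  where
  open ≡-Reasoning
  open ℚSolver.+-*-Solver

fold-unique : ∀ {F : ℕ → ℚ → ℚ} → (∀ x → F 0 x ≡ x) → (∀ k x → F (suc k) x ≡ - F k x) →
              ∀ k x → F k x ≡ fold x -_ k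
fold-unique F0 Fsuc zero    x = F0 x
fold-unique F0 Fsuc (suc k) x = trans (Fsuc k x) (cong -_ (fold-unique F0 Fsuc k x))

fold-neg-* : ∀ c x k → fold (c * x) -_ k ≡ c * fold x -_ k
fold-neg-* c x zero    = refl
fold-neg-* c x (suc k) = trans (cong -_ (fold-neg-* c x k)) (ℚP.neg-distribʳ-* c (fold x -_ k))

-- The sign of `sincCoeff` is computed by a where-bound function of `Defs`, which cannot be named;
-- this metavariable is solved to it by unification in `sincCoeff-suc`.
mutual
  sincSign : ℕ → ℕ → ℚ → ℚ
  sincSign = _

  sincCoeff-suc : ∀ j → sincCoeff (suc j) ≡ - fold (invFactorial (suc (2 ℕ.* suc j))) -_ j
  sincCoeff-suc j with suc j | invFactorial (suc (2 ℕ.* suc j))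
  ... | a | y = cong -_ (fold-unique {F = sincSign a} (λ _ → refl) (λ _ _ → refl) j y)

sincCoeff≡fold : ∀ j → sincCoeff j ≡ fold (invFactorial (suc (2 ℕ.* j))) -_ j
sincCoeff≡fold zero    = refl
sincCoeff≡fold (suc j) = sincCoeff-suc j

sincCoeff-recurrence : ∀ j → fromℕ (2 ℕ.* suc j) * (fromℕ (suc (2 ℕ.* suc j)) * sincCoeff (suc j)) ≡ - sincCoeff j
sincCoeff-recurrence j = begin
  a * (b * sincCoeff (suc j))            ≡⟨ cong (λ s → a * (b * s)) (sincCoeff-suc j) ⟩
  a * (b * fold x -_ (suc j))            ≡⟨ sym (trans (fold-neg-* a (b * x) (suc j)) (cong (_*_ a) (fold-neg-* b x (suc j)))) ⟩
  fold (a * (b * x)) -_ (suc j)          ≡⟨ cong (λ y → fold (a * y) -_ (suc j)) (invFactorial-suc (2 ℕ.* suc j)) ⟩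
  fold (a * invFactorial (2 ℕ.* suc j)) -_ (suc j)
    ≡⟨ cong (λ y → fold y -_ (suc j)) (trans (cong (λ n → fromℕ n * invFactorial n) (ℕP.*-suc 2 j)) (invFactorial-suc (suc (2 ℕ.* j)))) ⟩
  - fold (invFactorial (suc (2 ℕ.* j))) -_ j   ≡⟨ cong -_ (sym (sincCoeff≡fold j)) ⟩
  - sincCoeff j                                ∎
  where
  open ≡-Reasoning
  a b x : ℚ
  a = fromℕ (2 ℕ.* suc j)
  b = fromℕ (suc (2 ℕ.* suc j))
  x = invFactorial (suc (2 ℕ.* suc j))

-- cos z = (z S)′ = S + θ S, where S = sin z / z.
cosSeries : Series
cosSeries = sincCoeff ⊕ θ sincCoeff

cotSeries : Series
cotSeries = cosSeries ⊗ cscSeries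

private
  S c T C : Series
  S = sincCoeff
  c = cosSeries
  T = cscSeries
  C = cotSeries

opaque
  unfolding _⊕_ _⊗_ θ

  θ-cos : θ cosSeries ≈ ⊖ (z² ⊗ sincCoeff)
  θ-cos = mk≈ λ
    { zero    → trans (ℚP.*-zeroˡ (cosSeries 0)) (cong -_ (sym (z²-⊗-zero sincCoeff)))
    ; (suc j) → step j
    }
    where
    open ≡-Reasoning
    open ℚSolver.+-*-Solver
    step : ∀ j → θ cosSeries (suc j) ≡ - (z² ⊗ sincCoeff) (suc j)
    step j = begin
      a * (s + a * s)                        ≡⟨ cong (_*_ a) (solve 2 (λ a s → s :+ a :* s := (con 1ℚ :+ a) :* s) refl a s) ⟩
      a * ((1ℚ + a) * s)                     ≡⟨ cong (λ b → a * (b * s)) (sym (fromℕ-suc (2 ℕ.* suc j))) ⟩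
      a * (fromℕ (suc (2 ℕ.* suc j)) * s)    ≡⟨ sincCoeff-recurrence j ⟩
      - sincCoeff j                          ≡⟨ cong -_ (sym (z²-⊗-suc sincCoeff j)) ⟩
      - (z² ⊗ sincCoeff) (suc j)             ∎
      where
      a s : ℚ
      a = fromℕ (2 ℕ.* suc j)
      s = sincCoeff (suc j)

  pythagoras-at-0 : (cosSeries ⊗ cosSeries ⊕ z² ⊗ (sincCoeff ⊗ sincCoeff)) 0 ≡ 1ℚ
  pythagoras-at-0 = refl

pythagoras : cosSeries ⊗ cosSeries ⊕ z² ⊗ (sincCoeff ⊗ sincCoeff) ≈ scalar 1ℚ
pythagoras = θ-kernel θQ≈0 pythagoras-at-0
  where
  open SeriesSolver
  open ≈-Reasoning
  θQ≈0 : θ (c ⊗ c ⊕ z² ⊗ (S ⊗ S)) ≈ 𝟘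
  θQ≈0 = begin
    θ (c ⊗ c ⊕ z² ⊗ (S ⊗ S))
      ≈⟨ ≈-trans (θ-⊕ (c ⊗ c) (z² ⊗ (S ⊗ S))) (+-cong (θ-leibniz c c) (≈-trans (θ-leibniz z² (S ⊗ S)) (+-congˡ (*-congˡ (θ-leibniz S S))))) ⟩
    (θ c ⊗ c ⊕ c ⊗ θ c) ⊕ (θ z² ⊗ (S ⊗ S) ⊕ z² ⊗ (θ S ⊗ S ⊕ S ⊗ θ S))
      ≈⟨ +-cong (+-cong (*-congʳ θ-cos) (*-congˡ θ-cos)) (+-congʳ (*-congʳ θ-z²)) ⟩
    (⊖ (z² ⊗ S) ⊗ c ⊕ c ⊗ ⊖ (z² ⊗ S)) ⊕ ((z² ⊕ z²) ⊗ (S ⊗ S) ⊕ z² ⊗ (θ S ⊗ S ⊕ S ⊗ θ S))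
      ≈⟨ solve 3 (λ S S′ w → let c = S :+ S′ in
           (:- (w :* S) :* c :+ c :* :- (w :* S)) :+ ((w :+ w) :* (S :* S) :+ w :* (S′ :* S :+ S :* S′)) := con 0ℚ)
           ≈-refl S (θ S) z² ⟩
    scalar 0ℚ
      ≈⟨ scalar-0 ⟩
    𝟘 ∎

nth-++-< : ∀ (xs : List ℚ) y k → k < length xs → nth (xs ++ y ∷ []) k ≡ nth xs k
nth-++-< (x ∷ xs) y zero    _         = refl
nth-++-< (x ∷ xs) y (suc k) (s≤s k<n) = nth-++-< xs y k k<n

nth-++-length : ∀ (xs : List ℚ) y → nth (xs ++ y ∷ []) (length xs) ≡ y
nth-++-length []       y = refl
nth-++-length (x ∷ xs) y = nth-++-length xs y

length-cscCoeffs : ∀ n → length (cscCoeffs n) ≡ suc n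
length-cscCoeffs zero    = refl
length-cscCoeffs (suc n) = trans (LP.length-++ (cscCoeffs n)) (trans (cong (ℕ._+ 1) (length-cscCoeffs n)) (ℕP.+-comm (suc n) 1))

nth-cscCoeffs : ∀ n k → k ≤ n → nth (cscCoeffs n) k ≡ cscSeries k
nth-cscCoeffs zero    zero    _   = refl
nth-cscCoeffs (suc n) k       k≤1+n with ℕP.m≤n⇒m<n∨m≡n k≤1+n
... | inj₂ refl = refl
... | inj₁ k<1+n = trans (nth-++-< (cscCoeffs n) _ k (subst (k <_) (sym (length-cscCoeffs n)) k<1+n))
                         (nth-cscCoeffs n k (ℕP.≤-pred k<1+n))

cscSeries-suc : ∀ n → cscSeries (suc n) ≡ - sumBelow (suc n) (λ i → sincCoeff (suc i) * cscSeries (n ∸ i))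
cscSeries-suc n = begin
  nth (cscCoeffs n ++ next ∷ []) (suc n)            ≡⟨ cong (nth (cscCoeffs n ++ next ∷ [])) (sym (length-cscCoeffs n)) ⟩
  nth (cscCoeffs n ++ next ∷ []) (length (cscCoeffs n)) ≡⟨ nth-++-length (cscCoeffs n) next ⟩
  next                                              ≡⟨ cong -_ (sumBelow-cong (suc n) (λ i _ → cong (sincCoeff (suc i) *_) (nth-cscCoeffs n (n ∸ i) (ℕP.m∸n≤m n i)))) ⟩
  - sumBelow (suc n) (λ i → sincCoeff (suc i) * cscSeries (n ∸ i)) ∎
  where
  open ≡-Reasoning
  next : ℚ
  next = - sumBelow (suc n) (λ i → sincCoeff (suc i) * nth (cscCoeffs n) (n ∸ i))

opaque
  unfolding _⊗_

  sinc⊗csc : sincCoeff ⊗ cscSeries ≈ scalar 1ℚ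
  sinc⊗csc = mk≈ λ
    { zero    → refl
    ; (suc n) → trans (sumBelow-head (suc n) _)
                  (trans (cong (_+ rest n) (trans (ℚP.*-identityˡ _) (cscSeries-suc n))) (ℚP.+-inverseˡ (rest n)))
    }
    where
    rest : ℕ → ℚ
    rest n = sumBelow (suc n) (λ i → sincCoeff (suc i) * cscSeries (n ∸ i))

θ-csc : θ cscSeries ≈ (scalar 1ℚ ⊕ ⊖ cotSeries) ⊗ cscSeries
θ-csc = begin
  θ T
    ≈⟨ θ-reciprocal sinc⊗csc ⟩
  ⊖ (T ⊗ T ⊗ θ S)
    ≈⟨ solve 3 (λ S S′ T → :- (T :* T :* S′) := (con 1ℚ :- (S :+ S′) :* T) :* T :+ T :* (S :* T :- con 1ℚ)) ≈-refl S (θ S) T ⟩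
  (scalar 1ℚ ⊕ ⊖ C) ⊗ T ⊕ T ⊗ (S ⊗ T ⊕ ⊖ scalar 1ℚ)
    ≈⟨ +-congˡ (*-congˡ (+-congʳ sinc⊗csc)) ⟩
  (scalar 1ℚ ⊕ ⊖ C) ⊗ T ⊕ T ⊗ (scalar 1ℚ ⊕ ⊖ scalar 1ℚ)
    ≈⟨ solve 2 (λ C T → (con 1ℚ :- C) :* T :+ T :* (con 1ℚ :- con 1ℚ) := (con 1ℚ :- C) :* T) ≈-refl C T ⟩
  (scalar 1ℚ ⊕ ⊖ C) ⊗ T
    ∎
  where
  open SeriesSolver
  open ≈-Reasoning

cot²≈csc²-z² : cotSeries ⊗ cotSeries ≈ cscSeries ⊗ cscSeries ⊕ ⊖ z²
cot²≈csc²-z² = begin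
  c ⊗ T ⊗ (c ⊗ T)
    ≈⟨ solve 4 (λ c S T w → c :* T :* (c :* T) := (c :* c :+ w :* (S :* S)) :* (T :* T) :- w :* ((S :* T) :* (S :* T))) ≈-refl c S T z² ⟩
  (c ⊗ c ⊕ z² ⊗ (S ⊗ S)) ⊗ (T ⊗ T) ⊕ ⊖ (z² ⊗ ((S ⊗ T) ⊗ (S ⊗ T)))
    ≈⟨ +-cong (*-congʳ pythagoras) (-‿cong (*-congˡ (*-cong sinc⊗csc sinc⊗csc))) ⟩
  scalar 1ℚ ⊗ (T ⊗ T) ⊕ ⊖ (z² ⊗ (scalar 1ℚ ⊗ scalar 1ℚ))
    ≈⟨ solve 2 (λ T w → con 1ℚ :* (T :* T) :- w :* (con 1ℚ :* con 1ℚ) := T :* T :- w) ≈-refl T z² ⟩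
  T ⊗ T ⊕ ⊖ z²
    ∎
  where
  open SeriesSolver
  open ≈-Reasoning

θ-cot : θ cotSeries ≈ cotSeries ⊕ ⊖ (cscSeries ⊗ cscSeries)
θ-cot = begin
  θ (c ⊗ T)
    ≈⟨ θ-leibniz c T ⟩
  θ c ⊗ T ⊕ c ⊗ θ T
    ≈⟨ +-cong (*-congʳ θ-cos) (*-congˡ θ-csc) ⟩
  ⊖ (z² ⊗ S) ⊗ T ⊕ c ⊗ ((scalar 1ℚ ⊕ ⊖ (c ⊗ T)) ⊗ T)
    ≈⟨ solve 4 (λ c S T w → :- (w :* S) :* T :+ c :* ((con 1ℚ :- c :* T) :* T)
                           := :- (w :* (S :* T)) :+ c :* T :- c :* T :* (c :* T)) ≈-refl c S T z² ⟩
  ⊖ (z² ⊗ (S ⊗ T)) ⊕ c ⊗ T ⊕ ⊖ (c ⊗ T ⊗ (c ⊗ T))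
    ≈⟨ +-cong (+-congʳ (-‿cong (*-congˡ sinc⊗csc))) (-‿cong cot²≈csc²-z²) ⟩
  ⊖ (z² ⊗ scalar 1ℚ) ⊕ c ⊗ T ⊕ ⊖ (T ⊗ T ⊕ ⊖ z²)
    ≈⟨ solve 3 (λ C T w → :- (w :* con 1ℚ) :+ C :- (T :* T :- w) := C :- T :* T) ≈-refl (c ⊗ T) T z² ⟩
  c ⊗ T ⊕ ⊖ (T ⊗ T)
    ∎
  where
  open SeriesSolver
  open ≈-Reasoning

θ-1-cot : θ (scalar 1ℚ ⊕ ⊖ cotSeries) ≈ cscSeries ⊗ cscSeries ⊕ ⊖ cotSeries
θ-1-cot = begin
  θ (scalar 1ℚ ⊕ ⊖ C)                ≈⟨ ≈-trans (θ-⊕ (scalar 1ℚ) (⊖ C)) (+-cong (≈-trans (θ-scalar 1ℚ) (≈-sym scalar-0)) (≈-trans (θ-⊖ C) (-‿cong θ-cot))) ⟩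
  scalar 0ℚ ⊕ ⊖ (C ⊕ ⊖ (T ⊗ T))      ≈⟨ solve 2 (λ C T → con 0ℚ :- (C :- T :* T) := T :* T :- C) ≈-refl C T ⟩
  T ⊗ T ⊕ ⊖ C                        ∎
  where
  open SeriesSolver
  open ≈-Reasoning

-- The recurrence for c_{n,k}

cosecNum-ode : ∀ n → let N = fromℕ n; y = cosecNum n in
  θ (θ y) ⊕ scalar (N * (N + 1ℚ)) ⊗ y ⊕ scalar (N * N) ⊗ (z² ⊗ y)
    ≈ scalar (N + N + 1ℚ) ⊗ θ y ⊕ scalar (N * (N + 1ℚ)) ⊗ cosecNum (2 ℕ.+ n)
cosecNum-ode n = begin
  θ (θ y) ⊕ scalar (N * (N + 1ℚ)) ⊗ y ⊕ scalar (N * N) ⊗ (z² ⊗ y)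
    ≈⟨ +-cong (+-congˡ (*-congʳ m[m+1])) (*-congʳ (scalar-* N N)) ⟩
  θ (θ y) ⊕ m ⊗ (m ⊕ scalar 1ℚ) ⊗ y ⊕ m ⊗ m ⊗ (z² ⊗ y)
    ≈⟨ +-congʳ (+-congʳ θ²y) ⟩
  m ⊗ ((T ⊗ T ⊕ ⊖ C) ⊗ y ⊕ E ⊗ (m ⊗ (E ⊗ y))) ⊕ m ⊗ (m ⊕ scalar 1ℚ) ⊗ y ⊕ m ⊗ m ⊗ (z² ⊗ y)
    ≈⟨ solve 5 (λ m T C y w → let E = con 1ℚ :- C in
         m :* ((T :* T :- C) :* y :+ E :* (m :* (E :* y))) :+ m :* (m :+ con 1ℚ) :* y :+ m :* m :* (w :* y)
         := (m :+ m :+ con 1ℚ) :* (m :* (E :* y)) :+ m :* (m :+ con 1ℚ) :* (T :* (T :* y))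
            :+ m :* m :* y :* (C :* C :- (T :* T :- w))) ≈-refl m T C y z² ⟩
  (m ⊕ m ⊕ scalar 1ℚ) ⊗ (m ⊗ (E ⊗ y)) ⊕ m ⊗ (m ⊕ scalar 1ℚ) ⊗ (T ⊗ (T ⊗ y)) ⊕ m ⊗ m ⊗ y ⊗ (C ⊗ C ⊕ ⊖ (T ⊗ T ⊕ ⊖ z²))
    ≈⟨ +-congˡ (*-congˡ (+-congʳ cot²≈csc²-z²)) ⟩
  (m ⊕ m ⊕ scalar 1ℚ) ⊗ (m ⊗ (E ⊗ y)) ⊕ m ⊗ (m ⊕ scalar 1ℚ) ⊗ (T ⊗ (T ⊗ y)) ⊕ m ⊗ m ⊗ y ⊗ (T ⊗ T ⊕ ⊖ z² ⊕ ⊖ (T ⊗ T ⊕ ⊖ z²))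
    ≈⟨ solve 5 (λ a b m y X → a :+ b :+ m :* m :* y :* (X :- X) := a :+ b) ≈-refl
           ((m ⊕ m ⊕ scalar 1ℚ) ⊗ (m ⊗ (E ⊗ y))) (m ⊗ (m ⊕ scalar 1ℚ) ⊗ (T ⊗ (T ⊗ y))) m y (T ⊗ T ⊕ ⊖ z²) ⟩
  (m ⊕ m ⊕ scalar 1ℚ) ⊗ (m ⊗ (E ⊗ y)) ⊕ m ⊗ (m ⊕ scalar 1ℚ) ⊗ (T ⊗ (T ⊗ y))
    ≈⟨ +-cong (*-cong (≈-sym 2m+1) (≈-sym θy)) (*-cong (≈-sym m[m+1]) (≈-sym T²y)) ⟩
  scalar (N + N + 1ℚ) ⊗ θ y ⊕ scalar (N * (N + 1ℚ)) ⊗ cosecNum (2 ℕ.+ n)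
    ∎
  where
  open SeriesSolver
  open ≈-Reasoning
  N : ℚ
  N = fromℕ n
  y m E : Series
  y = cosecNum n
  m = scalar N
  E = scalar 1ℚ ⊕ ⊖ C
  m[m+1] : scalar (N * (N + 1ℚ)) ≈ m ⊗ (m ⊕ scalar 1ℚ)
  m[m+1] = ≈-trans (scalar-* N (N + 1ℚ)) (*-congˡ (scalar-+ N 1ℚ))
  2m+1 : scalar (N + N + 1ℚ) ≈ m ⊕ m ⊕ scalar 1ℚ
  2m+1 = ≈-trans (scalar-+ (N + N) 1ℚ) (+-congʳ (scalar-+ N N))
  T²y : cosecNum (2 ℕ.+ n) ≈ T ⊗ (T ⊗ y)
  T²y = ≈-trans (powSeries-suc T (suc n)) (*-congˡ (powSeries-suc T n))
  θy : θ y ≈ m ⊗ (E ⊗ y)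
  θy = θ-pow θ-csc n
  θ²y : θ (θ y) ≈ m ⊗ ((T ⊗ T ⊕ ⊖ C) ⊗ y ⊕ E ⊗ (m ⊗ (E ⊗ y)))
  θ²y = begin
    θ (θ y)                            ≈⟨ θ-cong θy ⟩
    θ (m ⊗ (E ⊗ y))                    ≈⟨ θ-scalar-⊗ N (E ⊗ y) ⟩
    m ⊗ θ (E ⊗ y)                      ≈⟨ *-congˡ (≈-trans (θ-leibniz E y) (+-cong (*-congʳ θ-1-cot) (*-congˡ θy))) ⟩
    m ⊗ ((T ⊗ T ⊕ ⊖ C) ⊗ y ⊕ E ⊗ (m ⊗ (E ⊗ y))) ∎

opaque
  unfolding _⊕_ θ

  cosecNum-recurrence : ∀ n k → let N = fromℕ n; a = fromℕ (2 ℕ.* suc k) in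
    (a - N) * (a - N - 1ℚ) * cosecNum n (suc k) + N * N * cosecNum n k ≡ N * (N + 1ℚ) * cosecNum (2 ℕ.+ n) (suc k)
  cosecNum-recurrence n k = begin
    (a - N) * (a - N - 1ℚ) * y + N * N * y′
      ≡⟨ solve 4 (λ a N y y′ → (a :- N) :* (a :- N :- con 1ℚ) :* y :+ N :* N :* y′
                               := (a :* (a :* y) :+ N :* (N :+ con 1ℚ) :* y :+ N :* N :* y′) :- (N :+ N :+ con 1ℚ) :* (a :* y))
                 refl a N y y′ ⟩
    (a * (a * y) + N * (N + 1ℚ) * y + N * N * y′) - (N + N + 1ℚ) * (a * y)
      ≡⟨ cong (_- (N + N + 1ℚ) * (a * y)) ode-at ⟩
    ((N + N + 1ℚ) * (a * y) + N * (N + 1ℚ) * z) - (N + N + 1ℚ) * (a * y)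
      ≡⟨ solve 3 (λ b c z → (b :+ c :* z) :- b := c :* z) refl ((N + N + 1ℚ) * (a * y)) (N * (N + 1ℚ)) z ⟩
    N * (N + 1ℚ) * z
      ∎
    where
    open ≡-Reasoning
    open ℚSolver.+-*-Solver
    N a y y′ z : ℚ
    N  = fromℕ n
    a  = fromℕ (2 ℕ.* suc k)
    y  = cosecNum n (suc k)
    y′ = cosecNum n k
    z  = cosecNum (2 ℕ.+ n) (suc k)
    ode-at : a * (a * y) + N * (N + 1ℚ) * y + N * N * y′ ≡ (N + N + 1ℚ) * (a * y) + N * (N + 1ℚ) * z
    ode-at = begin
      a * (a * y) + N * (N + 1ℚ) * y + N * N * y′
        ≡⟨ sym (cong₂ _+_ (cong (_+_ (a * (a * y))) (scalar-*ˡ _ (cosecNum n) (suc k)))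
                          (trans (scalar-*ˡ _ (z² ⊗ cosecNum n) (suc k)) (cong (_*_ (N * N)) (z²-⊗-suc (cosecNum n) k)))) ⟩
      _ ≡⟨ at (cosecNum-ode n) (suc k) ⟩
      _ ≡⟨ cong₂ _+_ (scalar-*ˡ _ (θ (cosecNum n)) (suc k)) (scalar-*ˡ _ (cosecNum (2 ℕ.+ n)) (suc k)) ⟩
      (N + N + 1ℚ) * (a * y) + N * (N + 1ℚ) * z
        ∎

-- Diagonal ratios

-- c_{2(m+k),k}, that is c_{2v,v−m} for v = m + k.
cosecDiagonal : ℕ → ℕ → ℚ
cosecDiagonal m k = cosecNum (2 ℕ.* (m ℕ.+ k)) k

cosecDiagonal-recurrence : ∀ m k → let N = fromℕ (2 ℕ.* (m ℕ.+ suc k)) in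
  fromℕ (2 ℕ.* m) * fromℕ (suc (2 ℕ.* m)) * cosecDiagonal m (suc k) + N * N * cosecDiagonal (suc m) k
    ≡ N * (N + 1ℚ) * cosecDiagonal (suc m) (suc k)
cosecDiagonal-recurrence m k = begin
  M * fromℕ (suc (2 ℕ.* m)) * cosecDiagonal m (suc k) + N * N * cosecDiagonal (suc m) k
    ≡⟨ cong₂ (λ c x → c * cosecDiagonal m (suc k) + N * N * x) coefficient
             (cong (λ j → cosecNum (2 ℕ.* j) k) (sym (ℕP.+-suc m k))) ⟩
  (a - N) * (a - N - 1ℚ) * cosecNum n (suc k) + N * N * cosecNum n k
    ≡⟨ cosecNum-recurrence n k ⟩
  N * (N + 1ℚ) * cosecNum (2 ℕ.+ n) (suc k)
    ≡⟨ cong (λ j → N * (N + 1ℚ) * cosecNum j (suc k)) (sym (ℕP.*-suc 2 (m ℕ.+ suc k))) ⟩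
  N * (N + 1ℚ) * cosecDiagonal (suc m) (suc k)
    ∎
  where
  open ≡-Reasoning
  n : ℕ
  n = 2 ℕ.* (m ℕ.+ suc k)
  M a N : ℚ
  M = fromℕ (2 ℕ.* m)
  a = fromℕ (2 ℕ.* suc k)
  N = fromℕ n
  coefficient : M * fromℕ (suc (2 ℕ.* m)) ≡ (a - N) * (a - N - 1ℚ)
  coefficient = begin
    M * fromℕ (suc (2 ℕ.* m))                 ≡⟨ cong (_*_ M) (fromℕ-suc (2 ℕ.* m)) ⟩
    M * (1ℚ + M)                              ≡⟨ solve 2 (λ M a → M :* (con 1ℚ :+ M) := (a :- (M :+ a)) :* (a :- (M :+ a) :- con 1ℚ)) refl M a ⟩
    (a - (M + a)) * (a - (M + a) - 1ℚ)        ≡⟨ cong (λ x → (a - x) * (a - x - 1ℚ)) (sym N≡M+a) ⟩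
    (a - N) * (a - N - 1ℚ)                    ∎
    where
    open ℚSolver.+-*-Solver
    N≡M+a : N ≡ M + a
    N≡M+a = trans (cong fromℕ (ℕP.*-distribˡ-+ 2 m (suc k))) (fromℕ-homo-+ (2 ℕ.* m) (2 ℕ.* suc k))

-- α, β, δ stand for c_{2v,v−1}, c_{2v,v−2}, c_{2v,v−3}, and H, P for the sums of j⁻², j⁻⁴ over 0 < j < v.
record RatioInvariant (α β δ H P : ℚ) : Set where
  field
    α≢0 : α ≢ 0ℚ
    β≡  : β ≡ + 3 / 2 * H * α
    δ≡  : δ ≡ + 15 / 4 * (H * H - P) * α

-- The hypotheses are the diagonal recurrences for m = 0, 1, 2 at N = 2v, and τ = 1/v².  Each right-hand
-- side is rewritten as a multiple of N² α plus a multiple of 4 − τ N², where those two hypotheses apply.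
ratioInvariant-step : ∀ {N τ α β δ α′ β′ δ′ H P} → N ≢ 0ℚ → N + 1ℚ ≢ 0ℚ → τ * (N * N) ≡ fromℕ 4 →
  N * N * α ≡ N * (N + 1ℚ) * α′ →
  fromℕ 6 * α + N * N * β ≡ N * (N + 1ℚ) * β′ →
  fromℕ 20 * β + N * N * δ ≡ N * (N + 1ℚ) * δ′ →
  RatioInvariant α β δ H P → RatioInvariant α′ β′ δ′ (H + τ) (P + τ * τ)
ratioInvariant-step {N} {τ} {α} {β} {δ} {α′} {β′} {δ′} {H} {P} N≢0 N+1≢0 τN²≡4 rec₁ rec₂ rec₃ inv =
  record { α≢0 = α′≢0 ; β≡ = *-cancelˡ-≢0 q q≢0 qβ′≡ ; δ≡ = *-cancelˡ-≢0 q q≢0 qδ′≡ }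
  where
  open RatioInvariant inv
  open ≡-Reasoning
  open ℚSolver.+-*-Solver
  q : ℚ
  q = N * (N + 1ℚ)
  q≢0 : q ≢ 0ℚ
  q≢0 = *-≢0 N≢0 N+1≢0
  α′≢0 : α′ ≢ 0ℚ
  α′≢0 α′≡0 = α≢0 (*-cancelˡ-≢0 (N * N) (*-≢0 N≢0 N≢0)
    (trans rec₁ (trans (cong (_*_ q) α′≡0) (trans (ℚP.*-zeroʳ q) (sym (ℚP.*-zeroʳ (N * N)))))))
  qβ′≡ : q * β′ ≡ q * (+ 3 / 2 * (H + τ) * α′)
  qβ′≡ = begin
    q * β′                                                   ≡⟨ sym rec₂ ⟩
    fromℕ 6 * α + N * N * β                                  ≡⟨ cong (λ b → fromℕ 6 * α + N * N * b) β≡ ⟩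
    fromℕ 6 * α + N * N * (+ 3 / 2 * H * α)
      ≡⟨ solve 4 (λ N τ α H →
           con (fromℕ 6) :* α :+ N :* N :* (con (+ 3 / 2) :* H :* α)
           := con (+ 3 / 2) :* (H :+ τ) :* (N :* N :* α) :+ con (+ 3 / 2) :* α :* (con (fromℕ 4) :- τ :* (N :* N)))
         refl N τ α H ⟩
    + 3 / 2 * (H + τ) * (N * N * α) + + 3 / 2 * α * (fromℕ 4 - τ * (N * N))
      ≡⟨ cong₂ (λ x y → + 3 / 2 * (H + τ) * x + + 3 / 2 * α * (fromℕ 4 - y)) rec₁ τN²≡4 ⟩
    + 3 / 2 * (H + τ) * (q * α′) + + 3 / 2 * α * (fromℕ 4 - fromℕ 4)
      ≡⟨ solve 5 (λ q H τ α α′ →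
           con (+ 3 / 2) :* (H :+ τ) :* (q :* α′) :+ con (+ 3 / 2) :* α :* (con (fromℕ 4) :- con (fromℕ 4))
           := q :* (con (+ 3 / 2) :* (H :+ τ) :* α′))
         refl q H τ α α′ ⟩
    q * (+ 3 / 2 * (H + τ) * α′)                             ∎
  qδ′≡ : q * δ′ ≡ q * (+ 15 / 4 * ((H + τ) * (H + τ) - (P + τ * τ)) * α′)
  qδ′≡ = begin
    q * δ′                                                   ≡⟨ sym rec₃ ⟩
    fromℕ 20 * β + N * N * δ                                 ≡⟨ cong₂ (λ b d → fromℕ 20 * b + N * N * d) β≡ δ≡ ⟩
    fromℕ 20 * (+ 3 / 2 * H * α) + N * N * (+ 15 / 4 * (H * H - P) * α)
      ≡⟨ solve 5 (λ N τ α H P →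
           con (fromℕ 20) :* (con (+ 3 / 2) :* H :* α) :+ N :* N :* (con (+ 15 / 4) :* (H :* H :- P) :* α)
           := con (+ 15 / 4) :* ((H :+ τ) :* (H :+ τ) :- (P :+ τ :* τ)) :* (N :* N :* α)
              :+ con (+ 15 / 2) :* H :* α :* (con (fromℕ 4) :- τ :* (N :* N)))
         refl N τ α H P ⟩
    + 15 / 4 * ((H + τ) * (H + τ) - (P + τ * τ)) * (N * N * α) + + 15 / 2 * H * α * (fromℕ 4 - τ * (N * N))
      ≡⟨ cong₂ (λ x y → + 15 / 4 * ((H + τ) * (H + τ) - (P + τ * τ)) * x + + 15 / 2 * H * α * (fromℕ 4 - y)) rec₁ τN²≡4 ⟩
    + 15 / 4 * ((H + τ) * (H + τ) - (P + τ * τ)) * (q * α′) + + 15 / 2 * H * α * (fromℕ 4 - fromℕ 4)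
      ≡⟨ solve 6 (λ q H τ α α′ P →
           con (+ 15 / 4) :* ((H :+ τ) :* (H :+ τ) :- (P :+ τ :* τ)) :* (q :* α′)
           :+ con (+ 15 / 2) :* H :* α :* (con (fromℕ 4) :- con (fromℕ 4))
           := q :* (con (+ 15 / 4) :* ((H :+ τ) :* (H :+ τ) :- (P :+ τ :* τ)) :* α′))
         refl q H τ α α′ P ⟩
    q * (+ 15 / 4 * ((H + τ) * (H + τ) - (P + τ * τ)) * α′)  ∎

invSquare : ℕ → ℚ
invSquare j = divℚ 1ℚ (fromℕ (j ℕ.* j))

harmonic₂ : ℕ → ℚ
harmonic₂ n = sumBelow n (λ i → invSquare (suc i))

harmonic₄ : ℕ → ℚ
harmonic₄ n = sumBelow n (λ i → divℚ 1ℚ (+ (suc i ^ 4) / 1))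

invSquare-inverse : ∀ j → invSquare (suc j) * (fromℕ (suc j) * fromℕ (suc j)) ≡ 1ℚ
invSquare-inverse j = trans (cong (_*_ (invSquare (suc j))) (sym (fromℕ-homo-* (suc j) (suc j))))
                            (divℚ-cancelʳ 1ℚ (fromℕ≢0 (suc j ℕ.* suc j)))

invFourth≡invSquare² : ∀ j → divℚ 1ℚ (+ (suc j ^ 4) / 1) ≡ invSquare (suc j) * invSquare (suc j)
invFourth≡invSquare² j = divℚ-unique (fromℕ≢0 (suc j ^ 4)) (begin
  τ * τ * fromℕ (suc j ^ 4)                   ≡⟨ cong (_*_ (τ * τ)) fourth ⟩
  τ * τ * (J * (J * (J * (J * 1ℚ))))          ≡⟨ solve 2 (λ τ J → τ :* τ :* (J :* (J :* (J :* (J :* con 1ℚ)))) := (τ :* (J :* J)) :* (τ :* (J :* J))) refl τ J ⟩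
  τ * (J * J) * (τ * (J * J))                 ≡⟨ cong₂ _*_ (invSquare-inverse j) (invSquare-inverse j) ⟩
  1ℚ                                          ∎)
  where
  open ≡-Reasoning
  open ℚSolver.+-*-Solver
  τ J : ℚ
  τ = invSquare (suc j)
  J = fromℕ (suc j)
  fourth : fromℕ (suc j ^ 4) ≡ J * (J * (J * (J * 1ℚ)))
  fourth = trans (fromℕ-homo-* (suc j) (suc j ^ 3)) (cong (_*_ J) (trans (fromℕ-homo-* (suc j) (suc j ^ 2))
             (cong (_*_ J) (trans (fromℕ-homo-* (suc j) (suc j ^ 1)) (cong (_*_ J) (fromℕ-homo-* (suc j) 1))))))

ratioInvariant : ∀ u → RatioInvariant (cosecDiagonal 1 (2 ℕ.+ u)) (cosecDiagonal 2 (1 ℕ.+ u)) (cosecDiagonal 3 u)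
                                      (harmonic₂ (2 ℕ.+ u)) (harmonic₄ (2 ℕ.+ u))
ratioInvariant zero    = record { α≢0 = λ () ; β≡ = refl ; δ≡ = refl }
ratioInvariant (suc u) = subst (RatioInvariant _ _ _ _) (cong (_+_ (harmonic₄ (2 ℕ.+ u))) (sym (invFourth≡invSquare² (2 ℕ.+ u))))
  (ratioInvariant-step (fromℕ≢0 n) N+1≢0 τN²≡4 rec₁ (cosecDiagonal-recurrence 1 (1 ℕ.+ u)) (cosecDiagonal-recurrence 2 u)
                       (ratioInvariant u))
  where
  open ≡-Reasoning
  n : ℕ
  n = 2 ℕ.* (3 ℕ.+ u)
  N τ V : ℚ
  N = fromℕ n
  τ = invSquare (3 ℕ.+ u)
  V = fromℕ (3 ℕ.+ u)
  N+1≢0 : N + 1ℚ ≢ 0ℚ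
  N+1≢0 = subst (_≢ 0ℚ) (trans (fromℕ-suc n) (ℚP.+-comm 1ℚ N)) (fromℕ≢0 (suc n))
  τN²≡4 : τ * (N * N) ≡ fromℕ 4
  τN²≡4 = begin
    τ * (N * N)                      ≡⟨ cong (λ x → τ * (x * x)) (fromℕ-homo-* 2 (3 ℕ.+ u)) ⟩
    τ * (fromℕ 2 * V * (fromℕ 2 * V)) ≡⟨ solve 2 (λ τ V → τ :* (con (fromℕ 2) :* V :* (con (fromℕ 2) :* V)) := con (fromℕ 4) :* (τ :* (V :* V))) refl τ V ⟩
    fromℕ 4 * (τ * (V * V))           ≡⟨ cong (_*_ (fromℕ 4)) (invSquare-inverse (2 ℕ.+ u)) ⟩
    fromℕ 4 * 1ℚ                      ≡⟨ ℚP.*-identityʳ (fromℕ 4) ⟩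
    fromℕ 4                           ∎
    where open ℚSolver.+-*-Solver
  rec₁ : N * N * cosecDiagonal 1 (2 ℕ.+ u) ≡ N * (N + 1ℚ) * cosecDiagonal 1 (3 ℕ.+ u)
  rec₁ = trans (sym (trans (cong (_+ N * N * cosecDiagonal 1 (2 ℕ.+ u)) (ℚP.*-zeroˡ (cosecDiagonal 0 (3 ℕ.+ u))))
                           (ℚP.+-identityˡ _)))
               (cosecDiagonal-recurrence 0 (2 ℕ.+ u))

cosecRatio₂ : ∀ u → divℚ (cosecDiagonal 2 (1 ℕ.+ u)) (cosecDiagonal 1 (2 ℕ.+ u)) ≡ + 3 / 2 * harmonic₂ (2 ℕ.+ u)
cosecRatio₂ u = divℚ-unique α≢0 (sym β≡)
  where open RatioInvariant (ratioInvariant u)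

cosecRatio₃ : ∀ u → divℚ (cosecDiagonal 3 u) (cosecDiagonal 1 (2 ℕ.+ u))
                    ≡ + 15 / 4 * (harmonic₂ (2 ℕ.+ u) * harmonic₂ (2 ℕ.+ u) - harmonic₄ (2 ℕ.+ u))
cosecRatio₃ u = divℚ-unique α≢0 (sym δ≡)
  where open RatioInvariant (ratioInvariant u)

mainTheorem7 : (v : ℕ) → 3 < v →
    let r : ℕ → ℚ
        r m = divℚ (cosecNum (2 ℕ.* v) (v ∸ m)) (cosecNum (2 ℕ.* v) (v ∸ 1))
    in sumBelow (v ∸ 1) (λ i → divℚ 1ℚ (+ (suc i ^ 4) / 1))
       ≡ (+ 4 / 9) * (r 2 * r 2) - (+ 4 / 15) * r 3
mainTheorem7 (suc (suc (suc (suc w)))) (s≤s (s≤s (s≤s (s≤s _)))) = begin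
  P
    ≡⟨ solve 2 (λ H P → P := con (+ 4 / 9) :* ((con (+ 3 / 2) :* H) :* (con (+ 3 / 2) :* H))
                             :- con (+ 4 / 15) :* (con (+ 15 / 4) :* (H :* H :- P))) refl H P ⟩
  + 4 / 9 * (+ 3 / 2 * H * (+ 3 / 2 * H)) - + 4 / 15 * (+ 15 / 4 * (H * H - P))
    ≡⟨ cong₂ (λ x y → + 4 / 9 * (x * x) - + 4 / 15 * y) (sym (cosecRatio₂ (suc w))) (sym (cosecRatio₃ (suc w))) ⟩
  + 4 / 9 * (r₂ * r₂) - + 4 / 15 * r₃
    ∎
  where
  open ≡-Reasoning
  open ℚSolver.+-*-Solver
  H P r₂ r₃ : ℚ
  H  = harmonic₂ (3 ℕ.+ w)
  P  = harmonic₄ (3 ℕ.+ w)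
  r₂ = divℚ (cosecDiagonal 2 (2 ℕ.+ w)) (cosecDiagonal 1 (3 ℕ.+ w))
  r₃ = divℚ (cosecDiagonal 3 (1 ℕ.+ w)) (cosecDiagonal 1 (3 ℕ.+ w))
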